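{- Let $k, l, s$ be positive integers. Let $m_1, \dots, m_s \in \mathbb{N}$ and $a_1, \dots, a_s \in \mathbb{N}$ satisfy $\gcd(m_i, m_j) = 1$ for all $i \neq j$, and $\gcd(a_i, m_i) = 1$ for all $i = 1, \dots, s$. Put $m = m_1 m_2 \cdots m_s$ and $M_i = m/m_i$ for $i = 1, \dots, s$. For each $i$ let $\overline{M}_i$ be a positive integer with $\overline{M}_i M_i \equiv 1 \pmod{m_i}$. Let $r_1, \dots, r_s$ be positive integers satisfying $r_i \equiv a_i M_i \overline{M}_i \pmod{m}$ for $i = 1, \dots, s$. Define \[ \mathcal{A} := \{ r_1 j_1 + r_2 j_2 + \cdots + r_s j_s + mk\, j_{s+1} : 0 \le j_i \le m_i - 1 \ (i = 1, \dots, s),\ 0 \le j_{s+1} \le l-1 \} \] and \[ \mathcal{B} := (mk\mathbb{N} \setminus mkl\mathbb{N}) \cup \bigcup_{i=1}^{s} (r_i \mathbb{N} \setminus r_i m_i \mathbb{N}). \] Then $P(\mathcal{A}; n) = Q(\mathcal{B}; n)$ for all $n \in \mathbb{N}$.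
   Context: $\mathbb{N} = \{1, 2, 3, \dots\}$. For $a \in \mathbb{N}$, $a\mathbb{N} = \{an : n \in \mathbb{N}\}$, and $X \setminus Y$ is set difference. A partition of $n$ is a finite non-increasing sequence of positive integers (parts) summing to $n$; the multiplicity of a part is the number of times it occurs. For $\mathcal{A} \subseteq \mathbb{N} \cup \{0\}$, $P(\mathcal{A}; n)$ denotes the number of partitions of $n$ in which the multiplicity of every part (that occurs) belongs to $\mathcal{A}$. For $\mathcal{B} \subseteq \mathbb{N}$, $Q(\mathcal{B}; n)$ denotes the number of partitions of $n$ all of whose parts belong to $\mathcal{B}$. By convention $P(\mathcal{A}; 0) = Q(\mathcal{B}; 0) = 1$. -}

module Defs where

open import Data.Nat using (ℕ; zero; suc; _+_; _*_; _≥_; _≤_; _≡ᵇ_; ∣_-_∣)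
open import Data.Nat.Properties using (_≟_)
open import Data.Nat.Divisibility using (_∣_; _∣?_)
open import Data.Bool using (Bool; T; _∧_; _∨_; not)
open import Data.Fin using (Fin)
open import Data.List using (List; []; _∷_; [_]; map; concatMap; upTo; allFin; filter; length)
open import Data.Nat.ListAction using (sum)
open import Data.Bool.ListAction using (any)
open import Data.List.Relation.Unary.All using (All)
open import Data.List.Relation.Unary.Linked using (Linked)
open import Data.Product using (Σ; _×_; proj₁)
open import Function using (_∘_)
open import Function.Bundles using (_↔_)
open import Relation.Nullary using (does)
open import Relation.Binary.PropositionalEquality using (_≡_)

infix 4 _≡_[mod_]
_≡_[mod_] : ℕ → ℕ → ℕ → Set
a ≡ b [mod n ] = n ∣ ∣ a - b ∣

Partition : ℕ → Set
Partition n = Σ (List ℕ) (λ ps → Linked _≥_ ps × All (λ p → 1 ≤ p) ps × sum ps ≡ n)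

mult : ℕ → List ℕ → ℕ
mult p ps = length (filter (_≟ p) ps)

-- Partitions of n in which the multiplicity of every occurring part lies in A
-- (A given by a Boolean membership test, so membership is proof-irrelevant).
PartsMult : (ℕ → Bool) → ℕ → Set
PartsMult A n = Σ (Partition n) (λ π → All (λ p → T (A (mult p (proj₁ π)))) (proj₁ π))

PartsIn : (ℕ → Bool) → ℕ → Set
PartsIn B n = Σ (Partition n) (λ π → All (λ p → T (B p)) (proj₁ π))

_HasSize_ : Set → ℕ → Set
X HasSize c = X ↔ Fin c

PNumberIs : (ℕ → Bool) → ℕ → ℕ → Set
PNumberIs A n c = PartsMult A n HasSize c

QNumberIs : (ℕ → Bool) → ℕ → ℕ → Set
QNumberIs B n c = PartsIn B n HasSize c

linCombs : (s : ℕ) → (Fin s → ℕ) → (Fin s → ℕ) → List ℕ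
linCombs zero r bd = [ 0 ]
linCombs (suc s) r bd =
  concatMap (λ j → map (λ x → r Fin.zero * j + x) (linCombs s (r ∘ Fin.suc) (bd ∘ Fin.suc)))
            (upTo (bd Fin.zero))

elemsA : (s : ℕ) → (r m : Fin s → ℕ) → (mk l : ℕ) → List ℕ
elemsA s r m mk l = concatMap (λ j → map (λ x → x + mk * j) (linCombs s r m)) (upTo l)

inA : (s : ℕ) → (r m : Fin s → ℕ) → (mk l : ℕ) → ℕ → Bool
inA s r m mk l x = any (λ y → y ≡ᵇ x) (elemsA s r m mk l)

inMultNotMult : ℕ → ℕ → ℕ → Bool
inMultNotMult d e x = does (d ∣? x) ∧ not (does ((d * e) ∣? x))

inB : (s : ℕ) → (r m : Fin s → ℕ) → (mk l : ℕ) → ℕ → Bool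
inB s r m mk l x =
  (1 Data.Nat.≤ᵇ x) ∧ (inMultNotMult mk l x ∨ any (λ i → inMultNotMult (r i) (m i) x) (allFin s))

{-# OPTIONS --safe #-}
-- A multiplicity in 𝒜 has a unique expansion ∑ w c * j c with digits j c < b c, where the
-- weights and bases are (m k, l) and (r i, m i): the r i are a i times Chinese-remainder
-- idempotents, so the digit j i is recovered modulo m i, and then the remaining digit.
-- A part t = b c ^ e * u (b c ∤ u) of multiplicity ∑ w c * j c is regrouped into j c * b c ^ e
-- copies of the part w c * u, which lies in ℬ; the pieces w c * {u : b c ∤ u} of ℬ are disjoint.
-- Conversely the multiplicity of w c * u is read in base b c, its e-th digit being the c-th
-- digit of the multiplicity of b c ^ e * u. This is Glaisher's bijection run in every component
-- at once, and it preserves the size, so P(𝒜; n) = Q(ℬ; n).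
module Submission where

open import Defs
open import Data.Bool using (Bool; T)
open import Data.Bool.ListAction using (any)
open import Data.Bool.Properties using (T-irrelevant; T-∧; T-∨)
open import Data.Fin using (Fin; zero; suc; toℕ; fromℕ<; fromℕ; inject₁; punchIn)
open import Data.Fin.Properties
  using (toℕ-injective; toℕ<n; toℕ-fromℕ<; toℕ-fromℕ; toℕ-inject₁; punchInᵢ≢i)
  renaming (suc-injective to fsuc-injective; _≟_ to _≟ᶠ_)
open import Data.List
  using (List; []; _∷_; [_]; _++_; replicate; filter; length; map; concatMap; upTo; allFin; deduplicate; lookup)
open import Data.List.Membership.Propositional using (_∈_; lose; find)
open import Data.List.Membership.Propositional.Properties
  using (∈-filter⁺; ∈-length; ∈-deduplicate⁺; ∈-lookup; ∈-concatMap⁺; ∈-concatMap⁻; ∈-map⁺; ∈-map⁻;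
         ∈-upTo⁺; ∈-upTo⁻; ∈-allFin)
open import Data.List.Membership.Propositional.Properties.WithK using (unique⇒irrelevant)
open import Data.List.Properties using (filter-accept; filter-reject; filter-none; filter-++; length-++; ≡-dec)
open import Data.List.Relation.Unary.All as All using (All; []; _∷_)
open import Data.List.Relation.Unary.All.Properties using (++⁺; map⁺)
open import Data.List.Relation.Unary.Any using (Any; here; there; index; any?)
open import Data.List.Relation.Unary.Any.Properties using (lookup-index; any⁺; any⁻)
open import Data.List.Relation.Unary.Linked as Linked using (Linked; []; [-]; _∷_; linked?)
open import Data.List.Relation.Unary.Linked.Properties using (Linked⇒All)
open import Data.List.Relation.Unary.Unique.DecPropositional.Properties using (deduplicate-!)
open import Data.Nat
open import Data.Nat.Coprimality using (Coprime; coprime-divisor)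
open import Data.Nat.DivMod
open import Data.Nat.Divisibility
open import Data.Nat.ListAction using (product; sum)
open import Data.Nat.ListAction.Properties using (sum-++; ∈⇒∣product; product≢0)
open import Data.Nat.Properties
open import Data.Nat.Tactic.RingSolver using (solve-∀)
open import Data.Product using (Σ; _×_; _,_; proj₁; proj₂; ∃; map₁)
open import Data.Sum using (_⊎_; inj₁; inj₂)
open import Data.Vec as Vec using (Vec; []; _∷_)
open import Data.Vec.Properties using (lookup∘tabulate)
open import Function using (_∘_; flip)
open import Function.Bundles using (_↔_; mk↔ₛ′; Equivalence)
open import Function.Construct.Composition using (_↔-∘_)
open import Relation.Binary.Definitions using (DecidableEquality)
open import Relation.Binary.PropositionalEquality hiding ([_])
open import Relation.Nullary using (¬_; Dec; yes; no; contradiction)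
open import Relation.Nullary.Decidable using (T?; map′; _×-dec_)
open import Algebra.Properties.CommutativeSemigroup *-commutativeSemigroup using (x∙yz≈y∙xz)
import Algebra.Properties.Semiring.Sum +-*-semiring as FinSum
open FinSum using (sum-cong-≗; sum-replicate-zero; sum-init-last; sum-remove; ∑-comm; *-distribˡ-sum)

-- The library's ∑[ i < n ] syntax discards n, which then cannot be inferred; this one keeps it.
infix 10 ∑
∑ : ∀ n → (Fin n → ℕ) → ℕ
∑ n f = FinSum.sum {n} f
syntax ∑ n (λ i → x) = ∑[ i < n ] x

∑-cong : ∀ {n} {f g : Fin n → ℕ} → (∀ i → f i ≡ g i) → ∑[ i < n ] f i ≡ ∑[ i < n ] g i
∑-cong = sum-cong-≗

∑-zero : ∀ {n} (f : Fin n → ℕ) → (∀ i → f i ≡ 0) → ∑[ i < n ] f i ≡ 0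
∑-zero {n} f f≡0 = trans (∑-cong f≡0) (sum-replicate-zero n)

∑-single : ∀ {n} (f : Fin n → ℕ) i → (∀ j → j ≢ i → f j ≡ 0) → ∑[ j < n ] f j ≡ f i
∑-single f zero others = trans (cong (f zero +_) (∑-zero _ (λ j → others (suc j) λ ()))) (+-identityʳ _)
∑-single {suc n} f (suc i) others = trans (cong (_+ ∑[ j < n ] f (suc j)) (others zero λ ()))
  (∑-single (f ∘ suc) i (λ j j≢i → others (suc j) (j≢i ∘ fsuc-injective)))

≤-∑ : ∀ {n} (f : Fin n → ℕ) i → f i ≤ ∑[ j < n ] f j
≤-∑ f zero = m≤m+n _ _
≤-∑ f (suc i) = ≤-trans (≤-∑ (f ∘ suc) i) (m≤n+m _ (f zero))

∑-positive : ∀ {n} (f : Fin n → ℕ) → 1 ≤ ∑[ i < n ] f i → ∃ λ i → 1 ≤ f i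
∑-positive {suc n} f pos with f zero in eq
... | suc _ = zero , subst (1 ≤_) (sym eq) (s≤s z≤n)
... | zero = let i , 1≤fi = ∑-positive (f ∘ suc) pos in suc i , 1≤fi

∣-∑ : ∀ {n d} (f : Fin n → ℕ) → (∀ i → d ∣ f i) → d ∣ ∑[ i < n ] f i
∣-∑ {zero} {d} f _ = d ∣0
∣-∑ {suc n} f d∣f = ∣m∣n⇒∣m+n (d∣f zero) (∣-∑ (f ∘ suc) (d∣f ∘ suc))

positive-factorˡ : ∀ {m n} → 1 ≤ m * n → 1 ≤ m
positive-factorˡ {m} pos = >-nonZero⁻¹ _ {{m*n≢0⇒m≢0 m {{>-nonZero pos}}}}

positive-factorʳ : ∀ m {n} → 1 ≤ m * n → 1 ≤ n
positive-factorʳ m pos = >-nonZero⁻¹ _ {{m*n≢0⇒n≢0 m {{>-nonZero pos}}}}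

-- Opaque, so that unification problems never expose the with-clauses of δ.
opaque
  δ : ℕ → ℕ → ℕ
  δ x y with x ≟ y
  ... | yes _ = 1
  ... | no _ = 0

  δ-≡ : ∀ x y → x ≡ y → δ x y ≡ 1
  δ-≡ x y x≡y with x ≟ y
  ... | yes _ = refl
  ... | no x≢y = contradiction x≡y x≢y

  δ-≢ : ∀ x y → x ≢ y → δ x y ≡ 0
  δ-≢ x y x≢y with x ≟ y
  ... | yes x≡y = contradiction x≡y x≢y
  ... | no _ = refl

  δ*-cong : ∀ x y {v v′} → (x ≡ y → v ≡ v′) → δ x y * v ≡ δ x y * v′
  δ*-cong x y v≡v′ with x ≟ y
  ... | yes x≡y = cong (1 *_) (v≡v′ x≡y)
  ... | no _ = refl

  δ*≢0⇒≡ : ∀ x y v → 1 ≤ δ x y * v → x ≡ y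
  δ*≢0⇒≡ x y v pos with x ≟ y
  ... | yes x≡y = x≡y
  ... | no _ = contradiction pos λ ()

  δ-*-cancelˡ : ∀ w x y → .{{NonZero w}} → δ (w * x) (w * y) ≡ δ x y
  δ-*-cancelˡ w x y with x ≟ y
  ... | yes refl = δ-≡ (w * x) (w * x) refl
  ... | no x≢y = δ-≢ (w * x) (w * y) (x≢y ∘ *-cancelˡ-≡ x y w)

part : ∀ {n} → Fin n → ℕ
part i = suc (toℕ i)

weight : ℕ → (ℕ → ℕ) → ℕ
weight n f = ∑[ i < n ] (part i * f (part i))

∑-δ : ∀ n y (F : ℕ → ℕ) → F y ≡ 0 ⊎ (1 ≤ y × y ≤ n) →
      ∑[ i < n ] (δ (part i) y * F (part i)) ≡ F y
∑-δ n y F (inj₁ Fy≡0) = trans (∑-zero {n} _ vanish) (sym Fy≡0)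
  where
  vanish : ∀ i → δ (part i) y * F (part i) ≡ 0
  vanish i = trans (δ*-cong (part i) y λ eq → subst (λ z → F z ≡ 0) (sym eq) Fy≡0) (*-zeroʳ (δ (part i) y))
∑-δ n (suc y) F (inj₂ (_ , y<n)) = trans (∑-single {n} _ p others)
  (trans (cong (_* F (part p)) (δ-≡ (part p) (suc y) part-p)) (trans (*-identityˡ _) (cong F part-p)))
  where
  p = fromℕ< y<n
  part-p : part p ≡ suc y
  part-p = cong suc (toℕ-fromℕ< y<n)
  others : ∀ j → j ≢ p → δ (part j) (suc y) * F (part j) ≡ 0
  others j j≢p = cong (_* F (part j)) (δ-≢ (part j) (suc y) λ eq →
    j≢p (toℕ-injective (suc-injective (trans eq (sym part-p)))))

weight-∑∑δ : ∀ n {K} (y : Fin K → Fin n → ℕ) (V : ℕ → Fin K → Fin n → ℕ) →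
             (∀ c t → V (y c t) c t ≡ 0 ⊎ (1 ≤ y c t × y c t ≤ n)) →
             weight n (λ x → ∑[ c < K ] ∑[ t < n ] (δ x (y c t) * V x c t))
             ≡ ∑[ c < K ] ∑[ t < n ] (y c t * V (y c t) c t)
weight-∑∑δ n {K} y V inRange = begin
    ∑[ i < n ] (part i * ∑[ c < K ] ∑[ t < n ] (δ (part i) (y c t) * V (part i) c t))
  ≡⟨ ∑-cong {n} (λ i → distrib (part i)) ⟩
    ∑[ i < n ] ∑[ c < K ] ∑[ t < n ] (δ (part i) (y c t) * F c t (part i))
  ≡⟨ ∑-comm {n} {K} (λ i c → ∑[ t < n ] (δ (part i) (y c t) * F c t (part i))) ⟩
    ∑[ c < K ] ∑[ i < n ] ∑[ t < n ] (δ (part i) (y c t) * F c t (part i))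
  ≡⟨ ∑-cong (λ c → ∑-comm {n} {n} (λ i t → δ (part i) (y c t) * F c t (part i))) ⟩
    ∑[ c < K ] ∑[ t < n ] ∑[ i < n ] (δ (part i) (y c t) * F c t (part i))
  ≡⟨ ∑-cong (λ c → ∑-cong λ t → ∑-δ n (y c t) (F c t) (Fy≡0-or-inRange c t)) ⟩
    ∑[ c < K ] ∑[ t < n ] (y c t * V (y c t) c t) ∎
  where
  open ≡-Reasoning
  F : Fin K → Fin n → ℕ → ℕ
  F c t x = x * V x c t
  Fy≡0-or-inRange : ∀ c t → F c t (y c t) ≡ 0 ⊎ (1 ≤ y c t × y c t ≤ n)
  Fy≡0-or-inRange c t with inRange c t
  ... | inj₁ V≡0 = inj₁ (trans (cong (y c t *_) V≡0) (*-zeroʳ (y c t)))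
  ... | inj₂ range = inj₂ range
  distrib : ∀ x → x * ∑[ c < K ] ∑[ t < n ] (δ x (y c t) * V x c t)
                  ≡ ∑[ c < K ] ∑[ t < n ] (δ x (y c t) * F c t x)
  distrib x = trans (*-distribˡ-sum {K} x _) (∑-cong λ c →
              trans (*-distribˡ-sum {n} x _) (∑-cong λ t → x∙yz≈y∙xz x (δ x (y c t)) _))

weight-suc : ∀ n h → weight (suc n) h ≡ weight n h + suc n * h (suc n)
weight-suc n h = begin
  weight (suc n) h
    ≡⟨ sum-init-last {n} (λ i → part i * h (part i)) ⟩
  ∑[ i < n ] (part (inject₁ i) * h (part (inject₁ i))) + part (fromℕ n) * h (part (fromℕ n))
    ≡⟨ cong₂ _+_ (∑-cong {n} λ i → cong (λ t → t * h t) (cong suc (toℕ-inject₁ i)))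
        (cong (λ t → t * h t) (cong suc (toℕ-fromℕ n))) ⟩
  weight n h + suc n * h (suc n) ∎
  where open ≡-Reasoning

weight-cong : ∀ n {f g} → (∀ t → 1 ≤ t → t ≤ n → f t ≡ g t) → weight n f ≡ weight n g
weight-cong n f≡g = ∑-cong {n} λ i → cong (part i *_) (f≡g (part i) (s≤s z≤n) (toℕ<n i))

term≤weight : ∀ n f {t} → 1 ≤ t → t ≤ n → t * f t ≤ weight n f
term≤weight n f {suc t} _ t<n = subst (λ p → p * f p ≤ weight n f) (cong suc (toℕ-fromℕ< t<n))
                                      (≤-∑ {n} (λ i → part i * f (part i)) (fromℕ< t<n))

-- Valuations and digits in base b

n<m^n : ∀ {m} n → 2 ≤ m → n < m ^ n
n<m^n zero _ = s≤s z≤n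
n<m^n {m} (suc n) 2≤m = begin-strict
  suc n           <⟨ s≤s (n<m^n n 2≤m) ⟩
  suc (m ^ n)     ≤⟨ +-monoˡ-≤ (m ^ n) (m^n>0 m n) ⟩
  m ^ n + m ^ n   ≤⟨ +-monoʳ-≤ (m ^ n) (m≤m+n (m ^ n) _) ⟩
  2 * m ^ n       ≤⟨ *-monoˡ-≤ (m ^ n) 2≤m ⟩
  m * m ^ n       ∎
  where
  open ≤-Reasoning
  instance _ = >-nonZero (≤-trans (s≤s z≤n) 2≤m)

private
  -- Splits t into b ^ e * u with b ∤ u; the fuel only ensures termination (fuel t suffices),
  -- and for b ≤ 1 nothing is split off.
  splitBy : ℕ → ℕ → ℕ → ℕ × ℕ
  splitBy (suc fuel) b@(suc (suc _)) t@(suc _) with b ∣? t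
  ... | yes _ = map₁ suc (splitBy fuel b (t / b))
  ... | no _ = 0 , t
  splitBy _ _ t = 0 , t

valuation cofactor : ℕ → ℕ → ℕ
valuation b t = proj₁ (splitBy t b t)
cofactor b t = proj₂ (splitBy t b t)

private
  splitBy-correct : ∀ fuel b t → b ^ proj₁ (splitBy fuel b t) * proj₂ (splitBy fuel b t) ≡ t
  splitBy-correct (suc fuel) b@(suc (suc _)) t@(suc _) with b ∣? t
  ... | no _ = *-identityˡ t
  ... | yes b∣t = begin
    b * b ^ e * u     ≡⟨ *-assoc b (b ^ e) u ⟩
    b * (b ^ e * u)   ≡⟨ cong (b *_) (splitBy-correct fuel b (t / b)) ⟩
    b * (t / b)       ≡⟨ m*[n/m]≡n b∣t ⟩
    t                 ∎
    where
    open ≡-Reasoning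
    e = proj₁ (splitBy fuel b (t / b))
    u = proj₂ (splitBy fuel b (t / b))
  splitBy-correct zero b t = *-identityˡ t
  splitBy-correct (suc fuel) zero t = *-identityˡ t
  splitBy-correct (suc fuel) (suc zero) t = *-identityˡ t
  splitBy-correct (suc fuel) (suc (suc b)) zero = refl

  splitBy-indivisible : ∀ fuel b t → 2 ≤ b → 1 ≤ t → t ≤ fuel → ¬ b ∣ proj₂ (splitBy fuel b t)
  splitBy-indivisible (suc fuel) b@(suc (suc _)) t@(suc _) _ _ t≤1+fuel with b ∣? t
  ... | no b∤t = b∤t
  ... | yes b∣t = splitBy-indivisible fuel b (t / b) (s≤s (s≤s z≤n)) (m≥n⇒m/n>0 (∣⇒≤ b∣t))
                    (<⇒≤pred (<-≤-trans (m/n<m t b (s≤s (s≤s z≤n))) t≤1+fuel))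
  splitBy-indivisible (suc fuel) (suc zero) _ (s≤s ())

b^valuation*cofactor : ∀ b t → b ^ valuation b t * cofactor b t ≡ t
b^valuation*cofactor b t = splitBy-correct t b t

cofactor-indivisible : ∀ {b t} → 2 ≤ b → 1 ≤ t → ¬ b ∣ cofactor b t
cofactor-indivisible {b} {t} 2≤b 1≤t = splitBy-indivisible t b t 2≤b 1≤t ≤-refl

pow*indivisible-injective : ∀ {b} e e′ {u u′} → 2 ≤ b → ¬ b ∣ u → ¬ b ∣ u′ →
                            b ^ e * u ≡ b ^ e′ * u′ → e ≡ e′ × u ≡ u′
pow*indivisible-injective zero zero _ _ _ eq = refl , trans (sym (*-identityˡ _)) (trans eq (*-identityˡ _))
pow*indivisible-injective {b} zero (suc e′) _ b∤u _ eq =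
  contradiction (divides (b ^ e′ * _)
    (trans (sym (*-identityˡ _)) (trans eq (trans (*-assoc b _ _) (*-comm b _))))) b∤u
pow*indivisible-injective {b} (suc e) zero _ _ b∤u′ eq =
  contradiction (divides (b ^ e * _)
    (trans (sym (*-identityˡ _)) (trans (sym eq) (trans (*-assoc b _ _) (*-comm b _))))) b∤u′
pow*indivisible-injective {b} (suc e) (suc e′) {u} {u′} 2≤b b∤u b∤u′ eq =
  map₁ (cong suc) (pow*indivisible-injective e e′ 2≤b b∤u b∤u′
    (*-cancelˡ-≡ (b ^ e * u) (b ^ e′ * u′) b {{>-nonZero (≤-trans (s≤s z≤n) 2≤b)}}
      (trans (sym (*-assoc b (b ^ e) u)) (trans eq (*-assoc b (b ^ e′) u′)))))

valuation-cofactor-pow* : ∀ {b} e {u} → 2 ≤ b → 1 ≤ u → ¬ b ∣ u →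
                          valuation b (b ^ e * u) ≡ e × cofactor b (b ^ e * u) ≡ u
valuation-cofactor-pow* {b} e {u} 2≤b 1≤u b∤u =
  pow*indivisible-injective (valuation b (b ^ e * u)) e 2≤b
    (cofactor-indivisible 2≤b (*-mono-≤ (m^n>0 b e) 1≤u)) b∤u (b^valuation*cofactor b (b ^ e * u))
  where instance _ = >-nonZero (≤-trans (s≤s z≤n) 2≤b)

cofactor-pos : ∀ b {t} → 1 ≤ t → 1 ≤ cofactor b t
cofactor-pos b {t} 1≤t = n≢0⇒n>0 λ c≡0 → <⇒≢ 1≤t (sym (begin
  t                                  ≡⟨ b^valuation*cofactor b t ⟨
  b ^ valuation b t * cofactor b t   ≡⟨ cong (b ^ valuation b t *_) c≡0 ⟩
  b ^ valuation b t * 0              ≡⟨ *-zeroʳ (b ^ valuation b t) ⟩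
  0                                  ∎))
  where open ≡-Reasoning

cofactor≤ : ∀ {b} t → 1 ≤ b → cofactor b t ≤ t
cofactor≤ {b} t 1≤b = ≤-trans (m≤n*m (cofactor b t) (b ^ valuation b t) {{m^n≢0 b (valuation b t) {{>-nonZero 1≤b}}}})
                              (≤-reflexive (b^valuation*cofactor b t))

valuation< : ∀ b {t} → 1 ≤ t → valuation b t < t
valuation< zero {suc _} _ = s≤s z≤n
valuation< (suc zero) {suc _} _ = s≤s z≤n
valuation< b@(suc (suc _)) {t} 1≤t = <-≤-trans (n<m^n (valuation b t) (s≤s (s≤s z≤n)))
  (≤-trans (m≤m*n (b ^ valuation b t) (cofactor b t) {{>-nonZero (cofactor-pos b 1≤t)}})
           (≤-reflexive (b^valuation*cofactor b t)))

digit : ℕ → ℕ → ℕ → ℕ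
digit zero _ _ = 0
digit (suc b) zero N = N % suc b
digit (suc b) (suc e) N = digit (suc b) e (N / suc b)

digit< : ∀ {B} e N → 1 ≤ B → digit B e N < B
digit< {suc b} zero N _ = m%n<n N (suc b)
digit< {suc b} (suc e) N _ = digit< e (N / suc b) (s≤s z≤n)

digit-zero : ∀ B e → digit B e 0 ≡ 0
digit-zero zero e = refl
digit-zero (suc b) zero = refl
digit-zero (suc b) (suc e) = digit-zero (suc b) e

digit≢0⇒B^e≤N : ∀ B e N → 1 ≤ digit B e N → B ^ e ≤ N
digit≢0⇒B^e≤N (suc b) zero zero pos = contradiction pos λ ()
digit≢0⇒B^e≤N (suc b) zero (suc N) _ = s≤s z≤n
digit≢0⇒B^e≤N (suc b) (suc e) N pos = begin
  suc b * suc b ^ e     ≡⟨ *-comm (suc b) _ ⟩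
  suc b ^ e * suc b     ≤⟨ *-monoˡ-≤ (suc b) (digit≢0⇒B^e≤N (suc b) e (N / suc b) pos) ⟩
  N / suc b * suc b     ≤⟨ m/n*n≤m N (suc b) ⟩
  N                     ∎
  where open ≤-Reasoning

private
  digit-expansion-step : ∀ B K (d : ℕ → ℕ) →
    ∑[ e < suc K ] (d (toℕ e) * B ^ toℕ e) ≡ d 0 + (∑[ e < K ] (d (suc (toℕ e)) * B ^ toℕ e)) * B
  digit-expansion-step B K d = cong₂ _+_ (*-identityʳ (d 0)) (begin
    ∑[ e < K ] (d (suc (toℕ e)) * (B * B ^ toℕ e))   ≡⟨ ∑-cong {K} (λ e → x∙yz≈y∙xz (d (suc (toℕ e))) B _) ⟩
    ∑[ e < K ] (B * (d (suc (toℕ e)) * B ^ toℕ e))   ≡⟨ *-distribˡ-sum {K} B _ ⟨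
    B * ∑[ e < K ] (d (suc (toℕ e)) * B ^ toℕ e)     ≡⟨ *-comm B _ ⟩
    (∑[ e < K ] (d (suc (toℕ e)) * B ^ toℕ e)) * B   ∎)
    where open ≡-Reasoning

∑-digits : ∀ {B} K N → 1 ≤ B → N < B ^ K → ∑[ e < K ] (digit B (toℕ e) N * B ^ toℕ e) ≡ N
∑-digits zero zero _ _ = refl
∑-digits zero (suc N) _ (s≤s ())
∑-digits {B@(suc b)} (suc K) N _ N<B^K = begin
  ∑[ e < suc K ] (digit B (toℕ e) N * B ^ toℕ e)        ≡⟨ digit-expansion-step B K (λ e → digit B e N) ⟩
  N % B + (∑[ e < K ] (digit B (toℕ e) (N / B) * B ^ toℕ e)) * B
      ≡⟨ cong (λ z → N % B + z * B) (∑-digits K (N / B) (s≤s z≤n) (m<n*o⇒m/o<n (subst (N <_) (*-comm B _) N<B^K))) ⟩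
  N % B + N / B * B                                       ≡⟨ m≡m%n+[m/n]*n N B ⟨
  N                                                       ∎
  where open ≡-Reasoning

digit-∑ : ∀ {B} K (d : ℕ → ℕ) → 1 ≤ B → (∀ e → d e < B) → ∀ {e₀} → e₀ < K →
          digit B e₀ (∑[ e < K ] (d (toℕ e) * B ^ toℕ e)) ≡ d e₀
digit-∑ {B@(suc b)} (suc K) d _ d<B {e₀} e₀<K = begin
  digit B e₀ (∑[ e < suc K ] (d (toℕ e) * B ^ toℕ e))   ≡⟨ cong (digit B e₀) (digit-expansion-step B K d) ⟩
  digit B e₀ (d 0 + higher * B)                          ≡⟨ lowest e₀ e₀<K ⟩
  d e₀                                                   ∎
  where
  open ≡-Reasoning
  higher = ∑[ e < K ] (d (suc (toℕ e)) * B ^ toℕ e)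
  lowest : ∀ e₀ → e₀ < suc K → digit B e₀ (d 0 + higher * B) ≡ d e₀
  lowest zero _ = trans ([m+kn]%n≡m%n (d 0) higher B) (m<n⇒m%n≡m (d<B 0))
  lowest (suc e₁) (s≤s e₁<K) = begin
    digit B e₁ ((d 0 + higher * B) / B)   ≡⟨ cong (digit B e₁) (+-distrib-/-∣ʳ (d 0) (n∣m*n higher)) ⟩
    digit B e₁ (d 0 / B + higher * B / B) ≡⟨ cong (digit B e₁) (cong₂ _+_ (m<n⇒m/n≡0 (d<B 0)) (m*n/n≡m higher B)) ⟩
    digit B e₁ higher                     ≡⟨ digit-∑ K (d ∘ suc) (s≤s z≤n) (d<B ∘ suc) e₁<K ⟩
    d (suc e₁)                            ∎

δ-cofactor : ∀ {b} n {u} (V : ℕ → ℕ → ℕ) → 2 ≤ b → 1 ≤ u → ¬ b ∣ u → ∀ {t} → 1 ≤ t → t ≤ n →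
             δ u (cofactor b t) * V t (valuation b t) ≡ ∑[ e < n ] (δ t (b ^ toℕ e * u) * V t (toℕ e))
δ-cofactor {b} n {u} V 2≤b 1≤u b∤u {t} 1≤t t≤n with u ≟ cofactor b t
... | no u≢ = begin
  δ u (cofactor b t) * V t (valuation b t)
    ≡⟨ cong (_* V t (valuation b t)) (δ-≢ _ _ u≢) ⟩
  0
    ≡⟨ ∑-zero {n} _ (λ e → cong (_* V t (toℕ e)) (δ-≢ _ _ (t≢ (toℕ e)))) ⟨
  ∑[ e < n ] (δ t (b ^ toℕ e * u) * V t (toℕ e)) ∎
  where
  open ≡-Reasoning
  t≢ : ∀ e → t ≢ b ^ e * u
  t≢ e t≡ = u≢ (sym (trans (cong (cofactor b) t≡) (proj₂ (valuation-cofactor-pow* e 2≤b 1≤u b∤u))))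
... | yes u≡ = begin
  δ u (cofactor b t) * V t v                       ≡⟨ cong (_* V t v) (trans (δ-≡ _ _ u≡) (sym (δ-≡ _ _ t≡b^v*u))) ⟩
  δ t (b ^ v * u) * V t v                          ≡⟨ cong (λ e → δ t (b ^ e * u) * V t e) (toℕ-fromℕ< v<n) ⟨
  δ t (b ^ toℕ e₀ * u) * V t (toℕ e₀)             ≡⟨ ∑-single {n} _ e₀ others ⟨
  ∑[ e < n ] (δ t (b ^ toℕ e * u) * V t (toℕ e))  ∎
  where
  open ≡-Reasoning
  v = valuation b t
  v<n = <-≤-trans (valuation< b 1≤t) t≤n
  e₀ = fromℕ< v<n
  t≡b^v*u : t ≡ b ^ v * u
  t≡b^v*u = trans (sym (b^valuation*cofactor b t)) (cong (b ^ v *_) (sym u≡))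
  others : ∀ e → e ≢ e₀ → δ t (b ^ toℕ e * u) * V t (toℕ e) ≡ 0
  others e e≢e₀ = cong (_* V t (toℕ e)) (δ-≢ t (b ^ toℕ e * u) λ t≡ → e≢e₀ (toℕ-injective (begin
    toℕ e                              ≡⟨ proj₁ (valuation-cofactor-pow* (toℕ e) 2≤b 1≤u b∤u) ⟨
    valuation b (b ^ toℕ e * u)        ≡⟨ cong (valuation b) t≡ ⟨
    v                                  ≡⟨ toℕ-fromℕ< v<n ⟨
    toℕ e₀                             ∎)))

∑-cofactor : ∀ {b} n {u} (V : ℕ → ℕ → ℕ) → 2 ≤ b → 1 ≤ u → ¬ b ∣ u →
             (∀ e → n < b ^ e * u → V (b ^ e * u) e ≡ 0) →
             ∑[ t < n ] (δ u (cofactor b (part t)) * V (part t) (valuation b (part t)))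
             ≡ ∑[ e < n ] V (b ^ toℕ e * u) (toℕ e)
∑-cofactor {b} n {u} V 2≤b 1≤u b∤u vanish = begin
  ∑[ t < n ] (δ u (cofactor b (part t)) * V (part t) (valuation b (part t)))
    ≡⟨ ∑-cong {n} (λ t → δ-cofactor n V 2≤b 1≤u b∤u (s≤s z≤n) (toℕ<n t)) ⟩
  ∑[ t < n ] ∑[ e < n ] (δ (part t) (b ^ toℕ e * u) * V (part t) (toℕ e))
    ≡⟨ ∑-comm {n} {n} (λ t e → δ (part t) (b ^ toℕ e * u) * V (part t) (toℕ e)) ⟩
  ∑[ e < n ] ∑[ t < n ] (δ (part t) (b ^ toℕ e * u) * V (part t) (toℕ e))
    ≡⟨ ∑-cong {n} (λ e → ∑-δ n (b ^ toℕ e * u) (λ t → V t (toℕ e)) (vanish-or-inRange (toℕ e))) ⟩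
  ∑[ e < n ] V (b ^ toℕ e * u) (toℕ e) ∎
  where
  open ≡-Reasoning
  vanish-or-inRange : ∀ e → V (b ^ e * u) e ≡ 0 ⊎ (1 ≤ b ^ e * u × b ^ e * u ≤ n)
  vanish-or-inRange e with b ^ e * u ≤? n
  ... | yes ≤n = inj₂ (*-mono-≤ (m^n>0 b {{>-nonZero (≤-trans (s≤s z≤n) 2≤b)}} e) 1≤u , ≤n)
  ... | no ≰n = inj₁ (vanish e (≰⇒> ≰n))

mult-cons-≡ : ∀ p xs → mult p (p ∷ xs) ≡ suc (mult p xs)
mult-cons-≡ p xs = cong length (filter-accept (_≟ p) refl)

mult-cons-≢ : ∀ {p x} xs → x ≢ p → mult p (x ∷ xs) ≡ mult p xs
mult-cons-≢ xs x≢p = cong length (filter-reject (_≟ _) x≢p)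

mult-++ : ∀ p xs ys → mult p (xs ++ ys) ≡ mult p xs + mult p ys
mult-++ p xs ys = trans (cong length (filter-++ (_≟ p) xs ys)) (length-++ (filter (_≟ p) xs))

mult-absent : ∀ {p xs} → All (_≢ p) xs → mult p xs ≡ 0
mult-absent x≢p = cong length (filter-none (_≟ _) x≢p)

mult-replicate-≡ : ∀ p c → mult p (replicate c p) ≡ c
mult-replicate-≡ p zero = refl
mult-replicate-≡ p (suc c) = trans (mult-cons-≡ p _) (cong suc (mult-replicate-≡ p c))

mult-replicate-≢ : ∀ {p x} c → x ≢ p → mult p (replicate c x) ≡ 0
mult-replicate-≢ zero _ = refl
mult-replicate-≢ (suc c) x≢p = trans (mult-cons-≢ _ x≢p) (mult-replicate-≢ c x≢p)

∈⇒mult≢0 : ∀ {p xs} → p ∈ xs → 1 ≤ mult p xs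
∈⇒mult≢0 {p} p∈xs = ∈-length (∈-filter⁺ (_≟ p) p∈xs refl)

mult≢0⇒∈ : ∀ {p} xs → 1 ≤ mult p xs → p ∈ xs
mult≢0⇒∈ {p} (x ∷ xs) pos with x ≟ p
... | yes x≡p = here (sym x≡p)
... | no x≢p = there (mult≢0⇒∈ xs (subst (1 ≤_) (mult-cons-≢ xs x≢p) pos))

fromMult : (ℕ → ℕ) → ℕ → List ℕ
fromMult h zero = []
fromMult h (suc n) = replicate (h (suc n)) (suc n) ++ fromMult h n

All-replicate : ∀ {P : ℕ → Set} c {x} → (1 ≤ c → P x) → All P (replicate c x)
All-replicate zero _ = []
All-replicate (suc c) Px = Px (s≤s z≤n) ∷ All-replicate c (λ _ → Px (s≤s z≤n))

All-fromMult : ∀ {P : ℕ → Set} h n → (∀ p → 1 ≤ p → p ≤ n → 1 ≤ h p → P p) → All P (fromMult h n)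
All-fromMult h zero _ = []
All-fromMult h (suc n) P-in-range = ++⁺ (All-replicate (h (suc n)) (P-in-range (suc n) (s≤s z≤n) ≤-refl))
  (All-fromMult h n λ p 1≤p p≤n → P-in-range p 1≤p (m≤n⇒m≤1+n p≤n))

fromMult-in-range : ∀ h n → All (λ p → 1 ≤ p × p ≤ n) (fromMult h n)
fromMult-in-range h n = All-fromMult h n λ _ 1≤p p≤n _ → 1≤p , p≤n

private
  cons-sorted : ∀ {x ys} → All (_≤ x) ys → Linked _≥_ ys → Linked _≥_ (x ∷ ys)
  cons-sorted [] _ = [-]
  cons-sorted (y≤x ∷ _) ys-sorted = y≤x ∷ ys-sorted

  replicate-++-sorted : ∀ c {x ys} → All (_≤ x) ys → Linked _≥_ ys → Linked _≥_ (replicate c x ++ ys)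
  replicate-++-sorted zero _ ys-sorted = ys-sorted
  replicate-++-sorted (suc c) ys≤x ys-sorted =
    cons-sorted (++⁺ (All-replicate c λ _ → ≤-refl) ys≤x) (replicate-++-sorted c ys≤x ys-sorted)

fromMult-sorted : ∀ h n → Linked _≥_ (fromMult h n)
fromMult-sorted h zero = []
fromMult-sorted h (suc n) = replicate-++-sorted (h (suc n))
  (All.map (λ range → m≤n⇒m≤1+n (proj₂ range)) (fromMult-in-range h n)) (fromMult-sorted h n)

sum-fromMult : ∀ h n → sum (fromMult h n) ≡ weight n h
sum-fromMult h zero = refl
sum-fromMult h (suc n) = begin
  sum (replicate (h (suc n)) (suc n) ++ fromMult h n)
    ≡⟨ sum-++ (replicate (h (suc n)) (suc n)) _ ⟩
  sum (replicate (h (suc n)) (suc n)) + sum (fromMult h n)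
    ≡⟨ cong₂ _+_ (sum-replicate (h (suc n)) (suc n)) (sum-fromMult h n) ⟩
  h (suc n) * suc n + weight n h
    ≡⟨ +-comm _ (weight n h) ⟩
  weight n h + h (suc n) * suc n
    ≡⟨ cong (weight n h +_) (*-comm (h (suc n)) (suc n)) ⟩
  weight n h + suc n * h (suc n)
    ≡⟨ weight-suc n h ⟨
  weight (suc n) h ∎
  where
  open ≡-Reasoning
  sum-replicate : ∀ c x → sum (replicate c x) ≡ c * x
  sum-replicate zero x = refl
  sum-replicate (suc c) x = cong (x +_) (sum-replicate c x)

mult-fromMult : ∀ h n p → 1 ≤ p → p ≤ n → mult p (fromMult h n) ≡ h p
mult-fromMult-out : ∀ h n p → n < p → mult p (fromMult h n) ≡ 0
mult-fromMult-out h n p n<p = mult-absent (All.map (λ range p≡ → <⇒≱ n<p (subst (_≤ n) p≡ (proj₂ range)))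
                                                    (fromMult-in-range h n))
mult-fromMult h zero (suc p) _ ()
mult-fromMult h (suc n) p 1≤p p≤1+n with p ≟ suc n
... | yes refl = begin
  mult p (replicate (h p) p ++ fromMult h n)
    ≡⟨ mult-++ p (replicate (h p) p) _ ⟩
  mult p (replicate (h p) p) + mult p (fromMult h n)
    ≡⟨ cong₂ _+_ (mult-replicate-≡ p (h p)) (mult-fromMult-out h n p ≤-refl) ⟩
  h p + 0
    ≡⟨ +-identityʳ (h p) ⟩
  h p ∎
  where open ≡-Reasoning
... | no p≢1+n = begin
  mult p (replicate (h (suc n)) (suc n) ++ fromMult h n)
    ≡⟨ mult-++ p (replicate (h (suc n)) (suc n)) _ ⟩
  mult p (replicate (h (suc n)) (suc n)) + mult p (fromMult h n)
    ≡⟨ cong₂ _+_ (mult-replicate-≢ (h (suc n)) (p≢1+n ∘ sym))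
        (mult-fromMult h n p 1≤p (≤-pred (≤∧≢⇒< p≤1+n p≢1+n))) ⟩
  h p ∎
  where open ≡-Reasoning

fromMult-cong : ∀ {h h′} n → (∀ p → 1 ≤ p → p ≤ n → h p ≡ h′ p) → fromMult h n ≡ fromMult h′ n
fromMult-cong zero _ = refl
fromMult-cong (suc n) h≡h′ = cong₂ _++_ (cong (λ c → replicate c (suc n)) (h≡h′ (suc n) (s≤s z≤n) ≤-refl))
                                        (fromMult-cong n λ p 1≤p p≤n → h≡h′ p 1≤p (m≤n⇒m≤1+n p≤n))

private
  ≤-head : ∀ {p y ys} → Linked _≥_ (y ∷ ys) → p ∈ y ∷ ys → p ≤ y
  ≤-head sorted = All.lookup (Linked⇒All (λ z≤y w≤z → ≤-trans w≤z z≤y) ≤-refl sorted)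

  head-mult : ∀ p xs → mult p (p ∷ xs) ≢ 0
  head-mult p xs eq = 0≢1+n (trans (sym eq) (mult-cons-≡ p xs))

sorted-mult-injective : ∀ {xs ys} → Linked _≥_ xs → Linked _≥_ ys → (∀ p → mult p xs ≡ mult p ys) → xs ≡ ys
sorted-mult-injective {[]} {[]} _ _ _ = refl
sorted-mult-injective {[]} {y ∷ ys} _ _ same = contradiction (sym (same y)) (head-mult y ys)
sorted-mult-injective {x ∷ xs} {[]} _ _ same = contradiction (same x) (head-mult x xs)
sorted-mult-injective {x ∷ xs} {y ∷ ys} xs-sorted ys-sorted same =
  cong₂ _∷_ x≡y (sorted-mult-injective (Linked.tail xs-sorted) (Linked.tail ys-sorted) same-tail)
  where
  x≡y : x ≡ y
  x≡y = ≤-antisym (≤-head ys-sorted (mult≢0⇒∈ (y ∷ ys)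
                    (subst (1 ≤_) (same x) (∈⇒mult≢0 {x} {x ∷ xs} (here refl)))))
                  (≤-head xs-sorted (mult≢0⇒∈ (x ∷ xs)
                    (subst (1 ≤_) (sym (same y)) (∈⇒mult≢0 {y} {y ∷ ys} (here refl)))))
  same-tail : ∀ p → mult p xs ≡ mult p ys
  same-tail p with x ≟ p
  ... | yes refl = suc-injective (begin
    suc (mult x xs)   ≡⟨ mult-cons-≡ x xs ⟨
    mult x (x ∷ xs)   ≡⟨ same x ⟩
    mult x (y ∷ ys)   ≡⟨ cong (λ z → mult x (z ∷ ys)) x≡y ⟨
    mult x (x ∷ ys)   ≡⟨ mult-cons-≡ x ys ⟩
    suc (mult x ys)   ∎)
    where open ≡-Reasoning
  ... | no x≢p = trans (sym (mult-cons-≢ xs x≢p)) (trans (same p) (mult-cons-≢ ys (x≢p ∘ trans x≡y)))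

parts≤sum : ∀ xs → All (_≤ sum xs) xs
parts≤sum [] = []
parts≤sum (x ∷ xs) = m≤m+n x _ ∷ All.map (λ y≤ → ≤-trans y≤ (m≤n+m _ x)) (parts≤sum xs)

partition≤ : ∀ {n} (π : Partition n) → All (_≤ n) (proj₁ π)
partition≤ (ps , _ , _ , refl) = parts≤sum ps

mult-partition-out : ∀ {n} (π : Partition n) p → n < p → mult p (proj₁ π) ≡ 0
mult-partition-out π p n<p = mult-absent (All.map (λ x≤n x≡p → <⇒≱ n<p (subst (_≤ _) x≡p x≤n)) (partition≤ π))

mult-partition-zero : ∀ {n} (π : Partition n) → mult 0 (proj₁ π) ≡ 0
mult-partition-zero (_ , _ , pos , _) = mult-absent (All.map (λ 1≤x x≡0 → <⇒≢ 1≤x (sym x≡0)) pos)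

fromMult-mult : ∀ {n} (π : Partition n) → fromMult (flip mult (proj₁ π)) n ≡ proj₁ π
fromMult-mult {n} π@(ps , sorted , _ , _) = sorted-mult-injective (fromMult-sorted _ n) sorted same
  where
  same : ∀ p → mult p (fromMult (flip mult ps) n) ≡ mult p ps
  same zero = trans (mult-absent (All.map (λ range p≡0 → <⇒≢ (proj₁ range) (sym p≡0)) (fromMult-in-range _ n)))
                    (sym (mult-partition-zero π))
  same (suc p) with suc p ≤? n
  ... | yes p≤n = mult-fromMult _ n (suc p) (s≤s z≤n) p≤n
  ... | no p≰n = trans (mult-fromMult-out _ n (suc p) (≰⇒> p≰n)) (sym (mult-partition-out π (suc p) (≰⇒> p≰n)))

weight-mult : ∀ {n} (π : Partition n) → weight n (flip mult (proj₁ π)) ≡ n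
weight-mult {n} π@(ps , _ , _ , ∑ps≡n) = trans (sym (sum-fromMult _ n)) (trans (cong sum (fromMult-mult π)) ∑ps≡n)

private
  partition-≡ : ∀ {n} {P : List ℕ → Set} → (∀ {ps} (p p′ : P ps) → p ≡ p′) →
                {π π′ : Σ (Partition n) (P ∘ proj₁)} → proj₁ (proj₁ π) ≡ proj₁ (proj₁ π′) → π ≡ π′
  partition-≡ P-irr {(ps , s , a , e) , p} {(.ps , s′ , a′ , e′) , p′} refl
    rewrite Linked.irrelevant ≤-irrelevant s s′ | All.irrelevant ≤-irrelevant a a′
          | ≡-irrelevant e e′ | P-irr p p′ = refl

PartsMult-≡ : ∀ {A n} {π π′ : PartsMult A n} → proj₁ (proj₁ π) ≡ proj₁ (proj₁ π′) → π ≡ π′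
PartsMult-≡ = partition-≡ (All.irrelevant T-irrelevant)

PartsIn-≡ : ∀ {B n} {π π′ : PartsIn B n} → proj₁ (proj₁ π) ≡ proj₁ (proj₁ π′) → π ≡ π′
PartsIn-≡ = partition-≡ (All.irrelevant T-irrelevant)

-- Glaisher's bijection for a mixed-radix system

-- 𝒜 is the set of sums ∑ w c * j c with digits j c < b c, each written in exactly one way
-- (coordinates given by coord), and ℬ is the union of the sets w c * {u : b c ∤ u}, which is disjoint.
record GlaisherData : Set where
  field
    K : ℕ
    w b : Fin K → ℕ
    w-pos : ∀ c → 1 ≤ w c
    b-pos : ∀ c → 1 ≤ b c
    A? B? : ℕ → Bool
    coord : Fin K → ℕ → ℕ
    coord<b : ∀ c x → coord c x < b c
    ∑-coord : ∀ x → T (A? x) → ∑[ c < K ] (w c * coord c x) ≡ x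
    coord-∑ : ∀ (j : Fin K → ℕ) → (∀ c → j c < b c) → ∀ c → coord c (∑[ c < K ] (w c * j c)) ≡ j c
    ∑∈A : ∀ (j : Fin K → ℕ) → (∀ c → j c < b c) → T (A? (∑[ c < K ] (w c * j c)))
    disjoint : ∀ {c c′ u u′} → w c * u ≡ w c′ * u′ → ¬ b c ∣ u → ¬ b c′ ∣ u′ → c ≡ c′
    ∈B⇒ : ∀ {x} → T (B? x) → ∃ λ c → ∃ λ u → x ≡ w c * u × ¬ b c ∣ u
    ∈B⇐ : ∀ {x} c u → 1 ≤ x → x ≡ w c * u → ¬ b c ∣ u → T (B? x)

module Glaisher (G : GlaisherData) where
  open GlaisherData G

  E U : Fin K → ℕ → ℕ
  E c = valuation (b c)
  U c = cofactor (b c)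

  0∈A : T (A? 0)
  0∈A = subst (T ∘ A?) (∑-zero {K} _ λ c → *-zeroʳ (w c)) (∑∈A (λ _ → 0) b-pos)

  coord-zero : ∀ c → coord c 0 ≡ 0
  coord-zero c = subst (λ x → coord c x ≡ 0) (∑-zero {K} _ λ c → *-zeroʳ (w c)) (coord-∑ (λ _ → 0) b-pos c)

  <b⇒2≤b : ∀ {c j} → 1 ≤ j → j < b c → 2 ≤ b c
  <b⇒2≤b 1≤j j<b = ≤-trans (s≤s 1≤j) j<b

  -- Inverse regrouping: the c-th coordinate of the multiplicity of t = b c ^ e * u is the
  -- e-th base-(b c) digit of the multiplicity g (w c * u).
  digitsOf : (ℕ → ℕ) → Fin K → ℕ → ℕ
  digitsOf g c t = digit (b c) (E c t) (g (w c * U c t))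

  digitsOf<b : ∀ g c t → digitsOf g c t < b c
  digitsOf<b g c t = digit< _ _ (b-pos c)

  toA : (ℕ → ℕ) → ℕ → ℕ
  toA g t = ∑[ c < K ] (w c * digitsOf g c t)

  toA∈A : ∀ g t → T (A? (toA g t))
  toA∈A g t = ∑∈A (λ c → digitsOf g c t) (λ c → digitsOf<b g c t)

  module _ (n : ℕ) where

    -- Glaisher's regrouping: each part t = b c ^ e * u (with b c ∤ u) contributes
    -- b c ^ e * d c t copies of the part w c * u.
    regroup : (Fin K → ℕ → ℕ) → ℕ → ℕ
    regroup d x = ∑[ c < K ] ∑[ t < n ] (δ x (w c * U c (part t)) * (d c (part t) * b c ^ E c (part t)))

    regroup-support : ∀ (d : Fin K → ℕ → ℕ) → (∀ c t → d c t < b c) → ∀ {x} → 1 ≤ regroup d x →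
                      ∃ λ c → ∃ λ u → x ≡ w c * u × ¬ b c ∣ u
    regroup-support d d<b {x} pos with ∑-positive {K} _ pos
    ... | c , pos′ with ∑-positive {n} _ pos′
    ... | t , pos″ = c , U c (part t) , δ*≢0⇒≡ x (w c * U c (part t)) _ pos″ ,
          cofactor-indivisible (<b⇒2≤b d-pos (d<b c (part t))) (s≤s z≤n)
      where
      d-pos : 1 ≤ d c (part t)
      d-pos = positive-factorˡ (positive-factorʳ (δ x (w c * U c (part t))) pos″)

    regroup-at : ∀ (d : Fin K → ℕ → ℕ) → (∀ c t → d c t < b c) → ∀ {c u} → 2 ≤ b c → 1 ≤ u → ¬ b c ∣ u →
                 (∀ e → n < b c ^ e * u → d c (b c ^ e * u) ≡ 0) →
                 regroup d (w c * u) ≡ ∑[ e < n ] (d c (b c ^ toℕ e * u) * b c ^ toℕ e)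
    regroup-at d d<b {c} {u} 2≤b 1≤u b∤u vanish = begin
      regroup d (w c * u)
        ≡⟨ ∑-single {K} _ c (λ c′ c′≢c → ∑-zero {n} _ λ t → other-component c′ c′≢c (part t) (s≤s z≤n)) ⟩
      ∑[ t < n ] (δ (w c * u) (w c * U c (part t)) * (d c (part t) * b c ^ E c (part t)))
        ≡⟨ ∑-cong {n} (λ t → cong (_* (d c (part t) * b c ^ E c (part t)))
                                  (δ-*-cancelˡ (w c) u (U c (part t)) {{>-nonZero (w-pos c)}})) ⟩
      ∑[ t < n ] (δ u (U c (part t)) * (d c (part t) * b c ^ E c (part t)))
        ≡⟨ ∑-cofactor n (λ t e → d c t * b c ^ e) 2≤b 1≤u b∤u (λ e out → cong (_* b c ^ e) (vanish e out)) ⟩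
      ∑[ e < n ] (d c (b c ^ toℕ e * u) * b c ^ toℕ e) ∎
      where
      open ≡-Reasoning
      other-component : ∀ c′ → c′ ≢ c → ∀ t → 1 ≤ t →
                        δ (w c * u) (w c′ * U c′ t) * (d c′ t * b c′ ^ E c′ t) ≡ 0
      other-component c′ c′≢c t 1≤t with d c′ t | d<b c′ t
      ... | zero | _ = *-zeroʳ (δ (w c * u) (w c′ * U c′ t))
      ... | suc j | d<b′ = cong (_* (suc j * b c′ ^ E c′ t)) (δ-≢ _ _ λ wu≡ →
              c′≢c (sym (disjoint wu≡ b∤u (cofactor-indivisible (<b⇒2≤b (s≤s z≤n) d<b′) 1≤t))))

    regroup-cong : ∀ {d d′ : Fin K → ℕ → ℕ} → (∀ c t → 1 ≤ t → t ≤ n → d c t ≡ d′ c t) →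
                   ∀ x → regroup d x ≡ regroup d′ x
    regroup-cong d≡d′ x = ∑-cong {K} λ c → ∑-cong {n} λ t →
      cong (λ j → δ x (w c * U c (part t)) * (j * b c ^ E c (part t))) (d≡d′ c (part t) (s≤s z≤n) (toℕ<n t))

    weight-regroup : ∀ (d : Fin K → ℕ → ℕ) → (∀ c t → 1 ≤ t → t ≤ n → 1 ≤ d c t → w c * U c t ≤ n) →
                     weight n (regroup d) ≡ ∑[ t < n ] (part t * ∑[ c < K ] (w c * d c (part t)))
    weight-regroup d bound = begin
      weight n (regroup d)
        ≡⟨ weight-∑∑δ n y (λ _ c t → d c (part t) * b c ^ E c (part t)) vanish-or-inRange ⟩
      ∑[ c < K ] ∑[ t < n ] (y c t * (d c (part t) * b c ^ E c (part t)))
        ≡⟨ ∑-cong {K} (λ c → ∑-cong {n} λ t → regroup-term c (part t)) ⟩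
      ∑[ c < K ] ∑[ t < n ] (part t * (w c * d c (part t)))
        ≡⟨ ∑-comm {K} {n} (λ c t → part t * (w c * d c (part t))) ⟩
      ∑[ t < n ] ∑[ c < K ] (part t * (w c * d c (part t)))
        ≡⟨ ∑-cong {n} (λ t → *-distribˡ-sum {K} (part t) (λ c → w c * d c (part t))) ⟨
      ∑[ t < n ] (part t * ∑[ c < K ] (w c * d c (part t))) ∎
      where
      open ≡-Reasoning
      y : Fin K → Fin n → ℕ
      y c t = w c * U c (part t)
      interchange : ∀ a u d p → (a * u) * (d * p) ≡ (p * u) * (a * d)
      interchange = solve-∀
      regroup-term : ∀ c t → (w c * U c t) * (d c t * b c ^ E c t) ≡ t * (w c * d c t)
      regroup-term c t = trans (interchange (w c) (U c t) (d c t) (b c ^ E c t))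
                               (cong (_* (w c * d c t)) (b^valuation*cofactor (b c) t))
      vanish-or-inRange : ∀ c t → d c (part t) * b c ^ E c (part t) ≡ 0 ⊎ (1 ≤ y c t × y c t ≤ n)
      vanish-or-inRange c t with d c (part t) in d≡
      ... | zero = inj₁ refl
      ... | suc _ = inj₂ (*-mono-≤ (w-pos c) (cofactor-pos (b c) (s≤s z≤n)) ,
                          bound c (part t) (s≤s z≤n) (toℕ<n t) (subst (1 ≤_) (sym d≡) (s≤s z≤n)))

    toB : (ℕ → ℕ) → ℕ → ℕ
    toB f = regroup (λ c t → coord c (f t))

    module FromA (f : ℕ → ℕ) (f-out : ∀ t → n < t → f t ≡ 0)
                 (f∈A : ∀ t → 1 ≤ t → t ≤ n → T (A? (f t))) (f-weight : weight n f ≡ n) where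

      coord-bound : ∀ c t → 1 ≤ t → t ≤ n → 1 ≤ coord c (f t) → w c * U c t ≤ n
      coord-bound c t 1≤t t≤n pos = begin
        w c * U c t
          ≤⟨ *-monoʳ-≤ (w c) (cofactor≤ t (b-pos c)) ⟩
        w c * t
          ≤⟨ *-monoˡ-≤ t (≤-trans (m≤m*n (w c) (coord c (f t)) {{>-nonZero pos}}) w*coord≤f) ⟩
        f t * t
          ≡⟨ *-comm (f t) t ⟩
        t * f t
          ≤⟨ term≤weight n f 1≤t t≤n ⟩
        weight n f
          ≡⟨ f-weight ⟩
        n ∎
        where
        open ≤-Reasoning
        w*coord≤f : w c * coord c (f t) ≤ f t
        w*coord≤f = ≤-trans (≤-∑ {K} (λ c → w c * coord c (f t)) c) (≤-reflexive (∑-coord (f t) (f∈A t 1≤t t≤n)))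

      toB-at : ∀ {c u} → 2 ≤ b c → 1 ≤ u → ¬ b c ∣ u →
               toB f (w c * u) ≡ ∑[ e < n ] (coord c (f (b c ^ toℕ e * u)) * b c ^ toℕ e)
      toB-at {c} 2≤b 1≤u b∤u = regroup-at _ (λ c t → coord<b c (f t)) 2≤b 1≤u b∤u
                                  (λ e out → trans (cong (coord c) (f-out _ out)) (coord-zero c))

      weight-toB : weight n (toB f) ≡ n
      weight-toB = begin
        weight n (toB f)
          ≡⟨ weight-regroup _ coord-bound ⟩
        ∑[ t < n ] (part t * ∑[ c < K ] (w c * coord c (f (part t))))
          ≡⟨ ∑-cong {n} (λ t → cong (part t *_)
              (∑-coord _ (f∈A (part t) (s≤s z≤n) (toℕ<n t)))) ⟩
        weight n f
          ≡⟨ f-weight ⟩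
        n ∎
        where open ≡-Reasoning

      toA-toB : ∀ g → (∀ x → 1 ≤ x → x ≤ n → g x ≡ toB f x) → (∀ x → n < x → g x ≡ 0) →
                ∀ t → 1 ≤ t → t ≤ n → toA g t ≡ f t
      toA-toB g g≡toB g-out t 1≤t t≤n =
        trans (∑-cong {K} λ c → cong (w c *_) (digit≡coord c)) (∑-coord (f t) (f∈A t 1≤t t≤n))
        where
        digit≡coord : ∀ c → digitsOf g c t ≡ coord c (f t)
        digit≡coord c with 2 ≤? b c
        ... | no b≱2 = trans (n<1⇒n≡0 (<-≤-trans (digitsOf<b g c t) b≤1))
                             (sym (n<1⇒n≡0 (<-≤-trans (coord<b c (f t)) b≤1)))
          where b≤1 = ≤-pred (≰⇒> b≱2)
        ... | yes 2≤b with w c * U c t ≤? n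
        ...   | yes ≤n = begin
          digit (b c) (E c t) (g (w c * U c t))
            ≡⟨ cong (digit (b c) (E c t))
                (trans (g≡toB _ (*-mono-≤ (w-pos c) 1≤U) ≤n) (toB-at 2≤b 1≤U b∤U)) ⟩
          digit (b c) (E c t) (∑[ e < n ] (coord c (f (b c ^ toℕ e * U c t)) * b c ^ toℕ e))
            ≡⟨ digit-∑ n (λ e → coord c (f (b c ^ e * U c t))) (b-pos c)
                (λ e → coord<b c _) (<-≤-trans (valuation< (b c) 1≤t) t≤n) ⟩
          coord c (f (b c ^ E c t * U c t))
            ≡⟨ cong (coord c ∘ f) (b^valuation*cofactor (b c) t) ⟩
          coord c (f t) ∎
          where
          open ≡-Reasoning
          1≤U = cofactor-pos (b c) 1≤t
          b∤U = cofactor-indivisible 2≤b 1≤t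
        ...   | no ≰n = trans (cong (digit (b c) (E c t)) (g-out _ (≰⇒> ≰n)))
                              (trans (digit-zero (b c) (E c t)) (sym coord≡0))
          where
          coord≡0 : coord c (f t) ≡ 0
          coord≡0 with coord c (f t) in eq
          ... | zero = refl
          ... | suc _ = contradiction (coord-bound c t 1≤t t≤n (subst (1 ≤_) (sym eq) (s≤s z≤n))) ≰n

    module FromB (g : ℕ → ℕ) (g-out : ∀ x → n < x → g x ≡ 0)
                 (g∈B : ∀ x → 1 ≤ g x → ∃ λ c → ∃ λ u → x ≡ w c * u × ¬ b c ∣ u)
                 (g-weight : weight n g ≡ n) where

      g≢0⇒≤n : ∀ x → 1 ≤ g x → x ≤ n
      g≢0⇒≤n x pos with x ≤? n
      ... | yes x≤n = x≤n
      ... | no x≰n = contradiction (g-out x (≰⇒> x≰n)) (≢-nonZero⁻¹ _ {{>-nonZero pos}})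

      x*gx≤n : ∀ {x} → 1 ≤ x → x ≤ n → x * g x ≤ n
      x*gx≤n 1≤x x≤n = ≤-trans (term≤weight n g 1≤x x≤n) (≤-reflexive g-weight)

      digit≢0⇒b^e*u≤n : ∀ {c u} e → 1 ≤ w c * u → 1 ≤ digit (b c) e (g (w c * u)) → b c ^ e * u ≤ n
      digit≢0⇒b^e*u≤n {c} {u} e 1≤x pos = begin
        b c ^ e * u               ≤⟨ *-monoˡ-≤ u (digit≢0⇒B^e≤N (b c) e _ pos) ⟩
        g (w c * u) * u           ≤⟨ *-monoʳ-≤ (g (w c * u)) (m≤n*m u (w c) {{>-nonZero (w-pos c)}}) ⟩
        g (w c * u) * (w c * u)   ≡⟨ *-comm (g (w c * u)) _ ⟩
        w c * u * g (w c * u)     ≤⟨ x*gx≤n 1≤x (g≢0⇒≤n _ gx≢0) ⟩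
        n                         ∎
        where
        open ≤-Reasoning
        gx≢0 : 1 ≤ g (w c * u)
        gx≢0 with g (w c * u) in eq
        ... | zero = contradiction (subst (1 ≤_) (digit-zero (b c) e) pos) λ ()
        ... | suc _ = s≤s z≤n

      regroup-digitsOf-vanishes : ∀ x → g x ≡ 0 → regroup (digitsOf g) x ≡ 0
      regroup-digitsOf-vanishes x gx≡0 = ∑-zero {K} _ λ c → ∑-zero {n} _ λ t → begin
        δ x (y c t) * (digit (b c) (E c (part t)) (g (y c t)) * b c ^ E c (part t))
          ≡⟨ δ*-cong x (y c t) (λ x≡ → cong (λ z → digit (b c) (E c (part t)) z * b c ^ E c (part t))
                                            (trans (cong g (sym x≡)) gx≡0)) ⟩
        δ x (y c t) * (digit (b c) (E c (part t)) 0 * b c ^ E c (part t))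
          ≡⟨ cong (λ z → δ x (y c t) * (z * b c ^ E c (part t))) (digit-zero (b c) (E c (part t))) ⟩
        δ x (y c t) * 0
          ≡⟨ *-zeroʳ (δ x (y c t)) ⟩
        0 ∎
        where
        open ≡-Reasoning
        y : Fin K → Fin n → ℕ
        y c t = w c * U c (part t)

      regroup-digitsOf-class : ∀ {c u} → 1 ≤ w c * u → w c * u ≤ n → ¬ b c ∣ u →
                               regroup (digitsOf g) (w c * u) ≡ g (w c * u)
      regroup-digitsOf-class {c} {u} 1≤x x≤n b∤u = begin
        regroup (digitsOf g) (w c * u)
          ≡⟨ regroup-at _ (digitsOf<b g) 2≤b 1≤u b∤u vanish ⟩
        ∑[ e < n ] (digitsOf g c (b c ^ toℕ e * u) * b c ^ toℕ e)
          ≡⟨ ∑-cong {n} (λ e → cong (_* b c ^ toℕ e) (digits-of-gx (toℕ e))) ⟩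
        ∑[ e < n ] (digit (b c) (toℕ e) (g (w c * u)) * b c ^ toℕ e)
          ≡⟨ ∑-digits n _ (b-pos c) gx<b^n ⟩
        g (w c * u) ∎
        where
        open ≡-Reasoning
        1≤u : 1 ≤ u
        1≤u = positive-factorʳ (w c) 1≤x
        2≤b : 2 ≤ b c
        2≤b with b c | b-pos c
        ... | suc zero | _ = contradiction (1∣ u) b∤u
        ... | suc (suc _) | _ = s≤s (s≤s z≤n)
        digits-of-gx : ∀ e → digitsOf g c (b c ^ e * u) ≡ digit (b c) e (g (w c * u))
        digits-of-gx e = cong₂ (λ e′ u′ → digit (b c) e′ (g (w c * u′)))
                               (proj₁ (valuation-cofactor-pow* e 2≤b 1≤u b∤u))
                               (proj₂ (valuation-cofactor-pow* e 2≤b 1≤u b∤u))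
        gx<b^n : g (w c * u) < b c ^ n
        gx<b^n = ≤-<-trans (≤-trans (m≤n*m _ (w c * u) {{>-nonZero 1≤x}}) (x*gx≤n 1≤x x≤n)) (n<m^n n 2≤b)
        vanish : ∀ e → n < b c ^ e * u → digitsOf g c (b c ^ e * u) ≡ 0
        vanish e out with digitsOf g c (b c ^ e * u) in eq
        ... | zero = refl
        ... | suc _ = contradiction (digit≢0⇒b^e*u≤n e 1≤x (subst (1 ≤_) (trans (sym eq) (digits-of-gx e)) (s≤s z≤n)))
                                    (<⇒≱ out)

      regroup-digitsOf : ∀ x → 1 ≤ x → x ≤ n → regroup (digitsOf g) x ≡ g x
      regroup-digitsOf x 1≤x x≤n with g x in gx≡
      ... | zero = regroup-digitsOf-vanishes x gx≡
      ... | suc _ with g∈B x (subst (1 ≤_) (sym gx≡) (s≤s z≤n))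
      ...   | c , u , refl , b∤u = trans (regroup-digitsOf-class 1≤x x≤n b∤u) gx≡

      weight-toA : weight n (toA g) ≡ n
      weight-toA = begin
        weight n (toA g)              ≡⟨ weight-regroup (digitsOf g) bound ⟨
        weight n (regroup (digitsOf g)) ≡⟨ weight-cong n regroup-digitsOf ⟩
        weight n g                    ≡⟨ g-weight ⟩
        n                             ∎
        where
        open ≡-Reasoning
        bound : ∀ c t → 1 ≤ t → t ≤ n → 1 ≤ digitsOf g c t → w c * U c t ≤ n
        bound c t _ _ pos = g≢0⇒≤n _ (≤-trans (m^n>0 (b c) {{>-nonZero (b-pos c)}} (E c t))
                                              (digit≢0⇒B^e≤N (b c) (E c t) _ pos))

      toB-toA : ∀ x → 1 ≤ x → x ≤ n → toB (toA g) x ≡ g x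
      toB-toA x 1≤x x≤n = trans (regroup-cong (λ c t _ _ → coord-∑ _ (λ c → digitsOf<b g c t) c) x)
                                (regroup-digitsOf x 1≤x x≤n)

    mult∈A : ∀ {ps} → All (λ p → T (A? (mult p ps))) ps → ∀ t → 1 ≤ t → t ≤ n → T (A? (mult t ps))
    mult∈A {ps} ps∈A t _ _ with mult t ps in eq
    ... | zero = 0∈A
    ... | suc _ = subst (T ∘ A?) eq (All.lookup ps∈A (mult≢0⇒∈ ps (subst (1 ≤_) (sym eq) (s≤s z≤n))))

    mult∈B : ∀ {qs} → All (T ∘ B?) qs → ∀ x → 1 ≤ mult x qs → ∃ λ c → ∃ λ u → x ≡ w c * u × ¬ b c ∣ u
    mult∈B {qs} qs∈B x pos = ∈B⇒ (All.lookup qs∈B (mult≢0⇒∈ qs pos))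

    toPartsB : PartsMult A? n → PartsIn B? n
    toPartsB (π@(ps , _) , ps∈A) =
      (fromMult (toB f) n , fromMult-sorted _ n , All.map proj₁ (fromMult-in-range _ n) , ∑≡n) , parts∈B
      where
      f = flip mult ps
      open FromA f (mult-partition-out π) (mult∈A ps∈A) (weight-mult π)
      ∑≡n = trans (sum-fromMult _ n) weight-toB
      parts∈B = All-fromMult _ n λ x 1≤x _ pos →
        let c , u , x≡ , b∤u = regroup-support _ (λ c t → coord<b c (f t)) pos in ∈B⇐ c u 1≤x x≡ b∤u

    toPartsA : PartsIn B? n → PartsMult A? n
    toPartsA (ρ@(qs , _) , qs∈B) =
      (fromMult (toA g) n , fromMult-sorted _ n , All.map proj₁ (fromMult-in-range _ n) , ∑≡n) , mults∈A
      where
      g = flip mult qs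
      open FromB g (mult-partition-out ρ) (mult∈B qs∈B) (weight-mult ρ)
      ∑≡n = trans (sum-fromMult _ n) weight-toA
      mults∈A = All-fromMult _ n λ t 1≤t t≤n _ → subst (T ∘ A?) (sym (mult-fromMult _ n t 1≤t t≤n)) (toA∈A g t)

    toPartsA∘toPartsB : ∀ π → toPartsA (toPartsB π) ≡ π
    toPartsA∘toPartsB (π@(ps , _) , ps∈A) = PartsMult-≡ {A?} (begin
      fromMult (toA (flip mult (fromMult (toB f) n))) n
        ≡⟨ fromMult-cong n (toA-toB _ (mult-fromMult _ n) (mult-fromMult-out _ n)) ⟩
      fromMult f n
        ≡⟨ fromMult-mult π ⟩
      ps ∎)
      where
      open ≡-Reasoning
      f = flip mult ps
      open FromA f (mult-partition-out π) (mult∈A ps∈A) (weight-mult π)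

    toPartsB∘toPartsA : ∀ ρ → toPartsB (toPartsA ρ) ≡ ρ
    toPartsB∘toPartsA (ρ@(qs , _) , qs∈B) = PartsIn-≡ {B?} (begin
      fromMult (toB (flip mult (fromMult (toA g) n))) n
        ≡⟨ fromMult-cong n (λ x _ _ → regroup-cong
            (λ c t 1≤t t≤n → cong (coord c) (mult-fromMult (toA g) n t 1≤t t≤n)) x) ⟩
      fromMult (toB (toA g)) n
        ≡⟨ fromMult-cong n toB-toA ⟩
      fromMult g n
        ≡⟨ fromMult-mult ρ ⟩
      qs ∎)
      where
      open ≡-Reasoning
      g = flip mult qs
      open FromB g (mult-partition-out ρ) (mult∈B qs∈B) (weight-mult ρ)

    glaisher : PartsMult A? n ↔ PartsIn B? n
    glaisher = mk↔ₛ′ toPartsB toPartsA toPartsB∘toPartsA toPartsA∘toPartsB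

-- Finiteness of the set of partitions

private
  index-∈-lookup : ∀ {X : Set} (xs : List X) i → index (∈-lookup {xs = xs} i) ≡ i
  index-∈-lookup (x ∷ xs) zero = refl
  index-∈-lookup (x ∷ xs) (suc i) = cong suc (index-∈-lookup xs i)

enumerable⇒finite : ∀ {X : Set} → DecidableEquality X → (L : List X) → (∀ x → x ∈ L) → ∃ λ c → X ↔ Fin c
enumerable⇒finite {X} _≟_ L complete = length L′ , mk↔ₛ′ (index ∘ complete′) (lookup L′) to∘from from∘to
  where
  L′ = deduplicate _≟_ L
  complete′ : ∀ x → x ∈ L′
  complete′ x = ∈-deduplicate⁺ _≟_ (complete x)
  to∘from : ∀ i → index (complete′ (lookup L′ i)) ≡ i
  to∘from i = trans (cong index (unique⇒irrelevant (deduplicate-! _≟_ L) _ (∈-lookup i))) (index-∈-lookup L′ i)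
  from∘to : ∀ x → lookup L′ (index (complete′ x)) ≡ x
  from∘to x = sym (lookup-index (complete′ x))

boundedLists : ℕ → ℕ → List (List ℕ)
boundedLists n zero = [ [] ]
boundedLists n (suc L) = [] ∷ concatMap (λ x → map (x ∷_) (boundedLists n L)) (upTo (suc n))

∈-boundedLists : ∀ n L {xs} → length xs ≤ L → All (_≤ n) xs → xs ∈ boundedLists n L
∈-boundedLists n zero {[]} _ _ = here refl
∈-boundedLists n (suc L) {[]} _ _ = here refl
∈-boundedLists n (suc L) {x ∷ xs} (s≤s len≤L) (x≤n ∷ xs≤n) = there (∈-concatMap⁺ _
  (lose (∈-upTo⁺ (s≤s x≤n)) (∈-map⁺ (x ∷_) (∈-boundedLists n L len≤L xs≤n))))

length≤sum : ∀ {xs} → All (1 ≤_) xs → length xs ≤ sum xs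
length≤sum [] = z≤n
length≤sum (1≤x ∷ xs-pos) = +-mono-≤ 1≤x (length≤sum xs-pos)

PartsIn-finite : ∀ B n → ∃ λ c → PartsIn B n ↔ Fin c
PartsIn-finite B n = enumerable⇒finite _≟ₚ_ (concatMap candidates (boundedLists n n)) complete
  where
  _≟ₚ_ : DecidableEquality (PartsIn B n)
  π ≟ₚ π′ = map′ (PartsIn-≡ {B}) (cong (proj₁ ∘ proj₁)) (≡-dec _≟_ (proj₁ (proj₁ π)) (proj₁ (proj₁ π′)))
  partsIn? : ∀ ps → Dec ((Linked _≥_ ps × All (1 ≤_) ps × sum ps ≡ n) × All (T ∘ B) ps)
  partsIn? ps = (linked? _≥?_ ps ×-dec All.all? (1 ≤?_) ps ×-dec sum ps ≟ n) ×-dec All.all? (T? ∘ B) ps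
  candidates : List ℕ → List (PartsIn B n)
  candidates ps with partsIn? ps
  ... | yes (π , ps∈B) = [ (ps , π) , ps∈B ]
  ... | no _ = []
  complete : ∀ π → π ∈ concatMap candidates (boundedLists n n)
  complete π@((ps , ps-partition@(_ , ps-pos , ∑ps≡n)) , ps∈B) = ∈-concatMap⁺ candidates
    (lose (∈-boundedLists n n (subst (length ps ≤_) ∑ps≡n (length≤sum ps-pos)) (partition≤ (proj₁ π))) π∈candidates)
    where
    π∈candidates : π ∈ candidates ps
    π∈candidates with partsIn? ps
    ... | yes _ = here (PartsIn-≡ {B} refl)
    ... | no ¬p = contradiction (ps-partition , ps∈B) ¬p

digitVectors : ∀ {K} → (Fin K → ℕ) → List (Vec ℕ K)
digitVectors {zero} _ = [ [] ]
digitVectors {suc K} b = concatMap (λ x → map (x ∷_) (digitVectors (b ∘ suc))) (upTo (b zero))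

∈-digitVectors⁺ : ∀ {K} (b j : Fin K → ℕ) → (∀ c → j c < b c) → Vec.tabulate j ∈ digitVectors b
∈-digitVectors⁺ {zero} b j _ = here refl
∈-digitVectors⁺ {suc K} b j j<b = ∈-concatMap⁺ _
  (lose (∈-upTo⁺ (j<b zero)) (∈-map⁺ (j zero ∷_) (∈-digitVectors⁺ (b ∘ suc) (j ∘ suc) (j<b ∘ suc))))

∈-digitVectors⁻ : ∀ {K} (b : Fin K → ℕ) {v} → v ∈ digitVectors b → ∀ c → Vec.lookup v c < b c
∈-digitVectors⁻ {suc K} b v∈ c
  with find (∈-concatMap⁻ (λ x → map (x ∷_) (digitVectors (b ∘ suc))) {xs = upTo (b zero)} v∈)
... | x , x∈ , v∈′ with ∈-map⁻ (x ∷_) v∈′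
... | v′ , v′∈ , refl with c
... | zero = ∈-upTo⁻ x∈
... | suc c′ = ∈-digitVectors⁻ (b ∘ suc) v′∈ c′

module MixedRadix {K : ℕ} (w b : Fin K → ℕ) where

  value : (Fin K → ℕ) → ℕ
  value j = ∑[ c < K ] (w c * j c)

  private
    representation? : ∀ x → Dec (Any (λ v → value (Vec.lookup v) ≡ x) (digitVectors b))
    representation? x = any? (λ v → value (Vec.lookup v) ≟ x) (digitVectors b)

  coordinates : ℕ → Fin K → ℕ
  coordinates x with representation? x
  ... | yes found = Vec.lookup (proj₁ (find found))
  ... | no _ = λ _ → 0

  coordinates<b : (∀ c → 1 ≤ b c) → ∀ x c → coordinates x c < b c
  coordinates<b b-pos x c with representation? x
  ... | yes found = ∈-digitVectors⁻ b (proj₁ (proj₂ (find found))) c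
  ... | no _ = b-pos c

  value-coordinates : ∀ {x} j → (∀ c → j c < b c) → x ≡ value j → value (coordinates x) ≡ x
  value-coordinates {x} j j<b x≡ with representation? x
  ... | yes found = proj₂ (proj₂ (find found))
  ... | no none = contradiction (lose (∈-digitVectors⁺ b j j<b) value-tabulate) none
    where
    value-tabulate : value (Vec.lookup (Vec.tabulate j)) ≡ x
    value-tabulate = trans (∑-cong {K} λ c → cong (w c *_) (lookup∘tabulate j c)) (sym x≡)

  coordinates-value : (∀ j j′ → (∀ c → j c < b c) → (∀ c → j′ c < b c) → value j ≡ value j′ → ∀ c → j c ≡ j′ c) →
                      (∀ c → 1 ≤ b c) → ∀ j → (∀ c → j c < b c) → ∀ c → coordinates (value j) c ≡ j c
  coordinates-value injective b-pos j j<b =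
    injective _ j (coordinates<b b-pos (value j)) j<b (value-coordinates j j<b refl)

∈-linCombs⁺ : ∀ s (r bd j : Fin s → ℕ) → (∀ i → j i < bd i) → MixedRadix.value r bd j ∈ linCombs s r bd
∈-linCombs⁺ zero r bd j _ = here refl
∈-linCombs⁺ (suc s) r bd j j<bd = ∈-concatMap⁺ _ (lose (∈-upTo⁺ (j<bd zero))
  (∈-map⁺ (r zero * j zero +_) (∈-linCombs⁺ s (r ∘ suc) (bd ∘ suc) (j ∘ suc) (j<bd ∘ suc))))

∈-linCombs⁻ : ∀ s (r bd : Fin s → ℕ) {y} → y ∈ linCombs s r bd →
              ∃ λ j → (∀ i → j i < bd i) × y ≡ MixedRadix.value r bd j
∈-linCombs⁻ zero r bd (here y≡0) = (λ ()) , (λ ()) , y≡0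
∈-linCombs⁻ (suc s) r bd y∈
  with find (∈-concatMap⁻ (λ j → map (r zero * j +_) (linCombs s (r ∘ suc) (bd ∘ suc))) {xs = upTo (bd zero)} y∈)
... | j₀ , j₀∈ , y∈′ with ∈-map⁻ (r zero * j₀ +_) y∈′
... | x , x∈ , refl with ∈-linCombs⁻ s (r ∘ suc) (bd ∘ suc) x∈
... | j , j<bd , refl = (λ { zero → j₀ ; (suc i) → j i }) , (λ { zero → ∈-upTo⁻ j₀∈ ; (suc i) → j<bd i }) , refl

inMultNotMult⇒ : ∀ d e x → T (inMultNotMult d e x) → ∃ λ u → x ≡ d * u × ¬ e ∣ u
inMultNotMult⇒ d e x x∈ with d ∣? x | (d * e) ∣? x
... | yes (divides u x≡) | no de∤x = u , trans x≡ (*-comm u d) , λ e∣u → de∤x (begin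
  d * e         ∣⟨ *-monoʳ-∣ d e∣u ⟩
  d * u         ≡⟨ trans (*-comm d u) (sym x≡) ⟩
  x             ∎)
  where open ∣-Reasoning

inMultNotMult⇐ : ∀ {d e x} u → 1 ≤ d → x ≡ d * u → ¬ e ∣ u → T (inMultNotMult d e x)
inMultNotMult⇐ {d} {e} {x} u 1≤d x≡ e∤u with d ∣? x | (d * e) ∣? x
... | yes _ | no _ = _
... | no d∤x | _ = d∤x (divides u (trans x≡ (*-comm d u)))
... | yes _ | yes de∣x = e∤u (*-cancelˡ-∣ d {{>-nonZero 1≤d}} (subst (d * e ∣_) x≡ de∣x))

module ABSets (s : ℕ) (r m : Fin s → ℕ) (mk l : ℕ) where

  w b : Fin (suc s) → ℕ
  w zero = mk
  w (suc i) = r i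
  b zero = l
  b (suc i) = m i

  open MixedRadix w b public

  ∈A⇒ : ∀ {x} → T (inA s r m mk l x) → ∃ λ J → (∀ c → J c < b c) × x ≡ value J
  ∈A⇒ {x} x∈ with find (any⁻ _ (elemsA s r m mk l) x∈)
  ... | y , y∈ , y≡ᵇx with find (∈-concatMap⁻ (λ j → map (_+ mk * j) (linCombs s r m)) {xs = upTo l} y∈)
  ... | j₀ , j₀∈ , y∈′ with ∈-map⁻ (_+ mk * j₀) y∈′
  ... | z , z∈ , refl with ∈-linCombs⁻ s r m z∈
  ... | j , j<m , refl = (λ { zero → j₀ ; (suc i) → j i }) , (λ { zero → ∈-upTo⁻ j₀∈ ; (suc i) → j<m i }) ,
                         trans (sym (≡ᵇ⇒≡ _ x y≡ᵇx)) (+-comm _ (mk * j₀))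

  ∈A⇐ : ∀ J → (∀ c → J c < b c) → T (inA s r m mk l (value J))
  ∈A⇐ J J<b = any⁺ _ (lose y∈ (≡⇒≡ᵇ _ _ (+-comm (MixedRadix.value r m (J ∘ suc)) (mk * J zero))))
    where
    y∈ : MixedRadix.value r m (J ∘ suc) + mk * J zero ∈ elemsA s r m mk l
    y∈ = ∈-concatMap⁺ _ (lose (∈-upTo⁺ (J<b zero)) (∈-map⁺ (_+ mk * J zero) (∈-linCombs⁺ s r m (J ∘ suc) (J<b ∘ suc))))

  ∈B⇒ : ∀ {x} → T (inB s r m mk l x) → ∃ λ c → ∃ λ u → x ≡ w c * u × ¬ b c ∣ u
  ∈B⇒ {x} x∈ with Equivalence.to T-∨ (proj₂ (Equivalence.to T-∧ x∈))
  ... | inj₁ x∈₀ = zero , inMultNotMult⇒ mk l x x∈₀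
  ... | inj₂ x∈ᵢ with find (any⁻ _ (allFin s) x∈ᵢ)
  ... | i , _ , x∈ᵢ′ = suc i , inMultNotMult⇒ (r i) (m i) x x∈ᵢ′

  ∈B⇐ : (∀ c → 1 ≤ w c) → ∀ {x} c u → 1 ≤ x → x ≡ w c * u → ¬ b c ∣ u → T (inB s r m mk l x)
  ∈B⇐ w-pos {x} c u 1≤x x≡ b∤u = Equivalence.from T-∧ (≤⇒≤ᵇ 1≤x , Equivalence.from T-∨ (in-component c x≡ b∤u))
    where
    in-component : ∀ c → x ≡ w c * u → ¬ b c ∣ u →
                   T (inMultNotMult mk l x) ⊎ T (any (λ i → inMultNotMult (r i) (m i) x) (allFin s))
    in-component zero x≡ b∤u = inj₁ (inMultNotMult⇐ u (w-pos zero) x≡ b∤u)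
    in-component (suc i) x≡ b∤u = inj₂ (any⁺ _ (lose (∈-allFin i) (inMultNotMult⇐ u (w-pos (suc i)) x≡ b∤u)))

-- Chinese remaindering

∣-respects-mod : ∀ {d x y} → x ≡ y [mod d ] → d ∣ y → d ∣ x
∣-respects-mod {d} {x} {y} d∣x-y d∣y with ≤-total x y
... | inj₁ x≤y = ∣m+n∣m⇒∣n (subst (d ∣_) (sym (m∸n+n≡m x≤y)) d∣y) (subst (d ∣_) (m≤n⇒∣m-n∣≡n∸m x≤y) d∣x-y)
... | inj₂ y≤x = ∣m∸n∣n⇒∣m d y≤x (subst (d ∣_) (trans (∣-∣-comm x y) (m≤n⇒∣m-n∣≡n∸m y≤x)) d∣x-y) d∣y

mod-sym : ∀ {d x y} → x ≡ y [mod d ] → y ≡ x [mod d ]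
mod-sym {d} {x} {y} = subst (d ∣_) (∣-∣-comm x y)

private
  cancel-mod-≤ : ∀ {d R A A′ x x′} → d ∣ A → d ∣ A′ → Coprime d R → x′ < d → x ≤ x′ →
                 R * x + A ≡ R * x′ + A′ → x ≡ x′
  cancel-mod-≤ {d} {R} {A} {A′} {x} {x′} d∣A d∣A′ cop x′<d x≤x′ eq with x′ ∸ x in δ≡
  ... | zero = sym (trans (sym (m+[n∸m]≡n x≤x′)) (trans (cong (x +_) δ≡) (+-identityʳ x)))
  ... | suc δ = contradiction (≤-trans (∣⇒≤ d∣δ) (≤-trans (≤-reflexive (sym δ≡)) (m∸n≤m x′ x))) (<⇒≱ x′<d)
    where
    A≡ : A ≡ R * suc δ + A′
    A≡ = +-cancelˡ-≡ (R * x) A _ (begin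
      R * x + A                   ≡⟨ eq ⟩
      R * x′ + A′                 ≡⟨ cong (λ z → R * z + A′) (trans (sym (m+[n∸m]≡n x≤x′)) (cong (x +_) δ≡)) ⟩
      R * (x + suc δ) + A′        ≡⟨ cong (_+ A′) (*-distribˡ-+ R x (suc δ)) ⟩
      R * x + R * suc δ + A′      ≡⟨ +-assoc (R * x) _ A′ ⟩
      R * x + (R * suc δ + A′)    ∎)
      where open ≡-Reasoning
    d∣δ : d ∣ suc δ
    d∣δ = coprime-divisor cop (∣m+n∣m⇒∣n (subst (d ∣_) (trans A≡ (+-comm _ A′)) d∣A) d∣A′)

cancel-mod : ∀ {d R A A′ x x′} → d ∣ A → d ∣ A′ → Coprime d R → x < d → x′ < d →
             R * x + A ≡ R * x′ + A′ → x ≡ x′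
cancel-mod {x = x} {x′} d∣A d∣A′ cop x<d x′<d eq with ≤-total x x′
... | inj₁ x≤x′ = cancel-mod-≤ d∣A d∣A′ cop x′<d x≤x′ eq
... | inj₂ x′≤x = sym (cancel-mod-≤ d∣A′ d∣A cop x<d x′≤x (sym eq))

module CRT (s : ℕ) (m a : Fin s → ℕ) (m≢0 : ∀ i → NonZero (m i))
           (m-coprime : ∀ i j → i ≢ j → Coprime (m i) (m j)) (a-coprime : ∀ i → Coprime (a i) (m i))
           (Mbar r : Fin s → ℕ) where

  mm : ℕ
  mm = product (map m (allFin s))

  M : Fin s → ℕ
  M i = _/_ mm (m i) {{m≢0 i}}

  mm-pos : 1 ≤ mm
  mm-pos = >-nonZero⁻¹ mm {{product≢0 (map⁺ {xs = allFin s} (All.tabulate λ {i} _ → m≢0 i))}}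

  m∣mm : ∀ i → m i ∣ mm
  m∣mm i = ∈⇒∣product (∈-map⁺ m (∈-allFin i))

  m∣M : ∀ {i j} → i ≢ j → m i ∣ M j
  m∣M {i} {j} i≢j = coprime-divisor (m-coprime i j i≢j)
                                    (subst (m i ∣_) (sym (m*[n/m]≡n {{m≢0 j}} (m∣mm j))) (m∣mm i))

  module _ (Mbar-inverse : ∀ i → Mbar i * M i ≡ 1 [mod m i ])
           (r≡ : ∀ i → r i ≡ a i * M i * Mbar i [mod mm ]) where

    m∣r : ∀ {i j} → i ≢ j → m i ∣ r j
    m∣r {i} {j} i≢j = ∣-respects-mod (∣-trans (m∣mm i) (r≡ j)) (∣m⇒∣m*n (Mbar j) (∣n⇒∣m*n (a j) (m∣M i≢j)))

    m-coprime-r : ∀ i → Coprime (m i) (r i)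
    m-coprime-r i {d} (d∣m , d∣r) = a-coprime i (d∣a , d∣m)
      where
      d∣aMMbar : d ∣ a i * (Mbar i * M i)
      d∣aMMbar = subst (d ∣_) (trans (*-assoc (a i) (M i) (Mbar i)) (cong (a i *_) (*-comm (M i) (Mbar i))))
                   (∣-respects-mod (mod-sym {x = r i} (∣-trans (∣-trans d∣m (m∣mm i)) (r≡ i))) d∣r)
      d∣a : d ∣ a i
      d∣a = subst (d ∣_) (*-identityʳ (a i)) (∣-respects-mod
              (subst (d ∣_) (*-distribˡ-∣-∣ (a i) 1 (Mbar i * M i))
                (∣n⇒∣m*n (a i) (mod-sym {x = Mbar i * M i} (∣-trans d∣m (Mbar-inverse i)))))
              d∣aMMbar)

    module _ (k l : ℕ) (1≤k : 1 ≤ k) (1≤l : 1 ≤ l) (1≤r : ∀ i → 1 ≤ r i) where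
      open ABSets s r m (mm * k) l

      w-pos : ∀ c → 1 ≤ w c
      w-pos zero = *-mono-≤ mm-pos 1≤k
      w-pos (suc i) = 1≤r i

      b-pos : ∀ c → 1 ≤ b c
      b-pos zero = 1≤l
      b-pos (suc i) = >-nonZero⁻¹ (m i) {{m≢0 i}}

      m∣w : ∀ {i} c → c ≢ suc i → m i ∣ w c
      m∣w {i} zero _ = ∣m⇒∣m*n k (m∣mm i)
      m∣w (suc j) sj≢si = m∣r (λ i≡j → sj≢si (cong suc (sym i≡j)))

      in-unit-component : ∀ i {c u u′} → w (suc i) * u ≡ w c * u′ → ¬ m i ∣ u → c ≡ suc i
      in-unit-component i {c} {u} {u′} eq m∤u with c ≟ᶠ suc i
      ... | yes c≡ = c≡
      ... | no c≢ = contradiction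
        (coprime-divisor (m-coprime-r i) (subst (m i ∣_) (sym eq) (∣m⇒∣m*n u′ (m∣w c c≢)))) m∤u

      disjoint : ∀ {c c′ u u′} → w c * u ≡ w c′ * u′ → ¬ b c ∣ u → ¬ b c′ ∣ u′ → c ≡ c′
      disjoint {zero} {zero} _ _ _ = refl
      disjoint {zero} {suc j} eq _ m∤u′ = in-unit-component j (sym eq) m∤u′
      disjoint {suc i} eq m∤u _ = sym (in-unit-component i eq m∤u)

      value-injective : ∀ J J′ → (∀ c → J c < b c) → (∀ c → J′ c < b c) → value J ≡ value J′ → ∀ c → J c ≡ J′ c
      value-injective J J′ J<b J′<b eq = component
        where
        unit-component : ∀ i → J (suc i) ≡ J′ (suc i)
        unit-component i =
          cancel-mod (∣-∑ _ (others J)) (∣-∑ _ (others J′)) (m-coprime-r i) (J<b (suc i)) (J′<b (suc i))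
            (trans (sym (sum-remove {i = suc i} (λ c → w c * J c)))
                   (trans eq (sum-remove {i = suc i} (λ c → w c * J′ c))))
          where
          others : ∀ J c → m i ∣ w (punchIn (suc i) c) * J (punchIn (suc i) c)
          others J c = ∣m⇒∣m*n _ (m∣w _ (punchInᵢ≢i (suc i) c))
        component : ∀ c → J c ≡ J′ c
        component zero = *-cancelˡ-≡ (J zero) (J′ zero) (mm * k) {{>-nonZero (w-pos zero)}}
          (+-cancelʳ-≡ _ _ _ (trans eq (cong (mm * k * J′ zero +_)
            (∑-cong {s} λ i → cong (r i *_) (sym (unit-component i))))))
        component (suc i) = unit-component i

      glaisherData : GlaisherData
      glaisherData = record
        { K = suc s ; w = w ; b = b ; w-pos = w-pos ; b-pos = b-pos
        ; A? = inA s r m (mm * k) l ; B? = inB s r m (mm * k) l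
        ; coord = λ c x → coordinates x c
        ; coord<b = λ c x → coordinates<b b-pos x c
        ; ∑-coord = λ x x∈A → let J , J<b , x≡ = ∈A⇒ x∈A in value-coordinates J J<b x≡
        ; coord-∑ = coordinates-value value-injective b-pos
        ; ∑∈A = ∈A⇐
        ; disjoint = disjoint
        ; ∈B⇒ = ∈B⇒
        ; ∈B⇐ = ∈B⇐ w-pos
        }

theorem1p7 : (k l s : ℕ) → 1 ≤ k → 1 ≤ l → 1 ≤ s →
    (m a : Fin s → ℕ) → (mpos : ∀ i → NonZero (m i)) → (∀ i → 1 ≤ a i) →
    (∀ i j → i ≢ j → Coprime (m i) (m j)) →
    (∀ i → Coprime (a i) (m i)) →
    let mm = product (map m (allFin s)) in
    let M = λ i → _/_ mm (m i) {{mpos i}} in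
    (Mbar : Fin s → ℕ) → (∀ i → 1 ≤ Mbar i) →
    (∀ i → Mbar i * M i ≡ 1 [mod m i ]) →
    (r : Fin s → ℕ) → (∀ i → 1 ≤ r i) →
    (∀ i → r i ≡ a i * M i * Mbar i [mod mm ]) →
    (n : ℕ) →
    Σ ℕ (λ c → PNumberIs (inA s r m (mm * k) l) n c × QNumberIs (inB s r m (mm * k) l) n c)
theorem1p7 k l s 1≤k 1≤l _ m a m≢0 _ m-coprime a-coprime Mbar _ Mbar-inverse r 1≤r r≡ n =
  let c , Q≅Fin = PartsIn-finite (GlaisherData.B? G) n in c , Q≅Fin ↔-∘ Glaisher.glaisher G n , Q≅Fin
  where
  G = CRT.glaisherData s m a m≢0 m-coprime a-coprime Mbar r Mbar-inverse r≡ k l 1≤k 1≤l 1≤r
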